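{- Let $P$ be a normal logic program and let $W$ be its well-founded model. Then $W\subseteq\mathit{expand}(P,\emptyset)$.
   Context: Fix a set $\mathit{Atoms}$ of atoms. A literal is an atom $a$ or a not-atom $\mathit{not}\ a$; $\overline{a}=\mathit{not}\ a$, $\overline{\mathit{not}\ a}=a$. A normal logic program is a finite set of basic rules $r$: $h\leftarrow a_1,\dots,a_n,\mathit{not}\ b_1,\dots,\mathit{not}\ b_m$, with $f_r(S,C)=\{h\}$ if $a_1,\dots,a_n\in C$ and $b_1,\dots,b_m\notin S$, else $\emptyset$ ($S,C\subseteq\mathit{Atoms}$). $\mathrm{Atoms}(P)$ is the set of atoms occurring in $P$. For a set of literals $A$: $A^+=\{a\mid a\in A\}$, $A^-=\{a\mid\mathit{not}\ a\in A\}$. Well-founded model: for $A\subseteq\mathit{Atoms}$ let $\Gamma_P(A)$ be the least fixed point of $X\mapsto\bigcup_{r\in P}f_r(A,X)$; $\Gamma_P^2(A)=\Gamma_P(\Gamma_P(A))$ is monotone. $W$ is the set of literals with $W^+=\mathrm{lfp}(\Gamma_P^2)$ and $W^-=\mathrm{Atoms}(P)\setminus\mathrm{gfp}(\Gamma_P^2)$. For a rule $r$: $\mathit{min}_r(A)=\bigcap\{f_r(C,C)\mid A^+\subseteq C\subseteq\mathit{Atoms},A^-\cap C=\emptyset\}$ (empty intersection $=\mathit{Atoms}$), $\mathit{max}_r(A)=\bigcup\{f_r(C,C)\mid A^+\subseteq C\subseteq\mathit{Atoms},A^-\cap C=\emptyset\}$. $\mathrm{Atleast}(P,A)$ is the least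 fixed point of the operator on sets of literals $f(B)=A\cup B\cup\{a\in\mathit{min}_r(B)\mid a\in\mathrm{Atoms}(P),r\in P\}\cup\{\mathit{not}\ a\mid a\in\mathrm{Atoms}(P),\ a\notin\mathit{max}_r(B)\ \forall r\in P\}\cup\{\overline{x}\mid\exists a\in B:\ a\in\mathit{max}_r(B)\text{ for exactly one }r\in P\text{ and }a\notin\mathit{max}_r(B\cup\{x\})\}\cup\{\overline{x}\mid\exists\,\mathit{not}\ a\in B,\exists r\in P:\ a\in\mathit{min}_r(B\cup\{x\})\}$. $\mathrm{Atmost}(P,A)$ is the least fixed point of $X\mapsto\bigcup_{r\in P}f_r(A^+,X\setminus A^-)\setminus A^-$ on subsets of $\mathit{Atoms}$. $\mathit{expand}(P,A)$ is computed by repeating $A:=\mathrm{Atleast}(P,A)$ followed by $A:=A\cup\{\mathit{not}\ x\mid x\in\mathrm{Atoms}(P),\ x\notin\mathrm{Atmost}(P,A)\}$ until $A$ no longer changes, and returning the final $A$. -}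

module Defs where

open import Level using (Level; _⊔_) renaming (zero to lzero; suc to lsuc)
open import Data.Nat using (ℕ; zero; suc)
open import Data.List using (List)
open import Data.List.Membership.Propositional using (_∈_)
open import Data.List.Relation.Unary.All using (All)
open import Data.List.Relation.Unary.Any using (Any)
open import Data.Product using (Σ; ∃; _×_)
open import Data.Sum using (_⊎_)
open import Data.Empty.Polymorphic using (⊥)
open import Relation.Nullary using (¬_)
open import Relation.Binary.PropositionalEquality using (_≡_)

data Lit (Atom : Set) : Set where
  pos : Atom → Lit Atom
  neg : Atom → Lit Atom

bar : {Atom : Set} → Lit Atom → Lit Atom
bar (pos a) = neg a
bar (neg a) = pos a

record Rule (Atom : Set) : Set where
  constructor _←_,_
  field
    head    : Atom
    posBody : List Atom
    negBody : List Atom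
open Rule public

-- a normal logic program: a finite set of basic rules (given as a list)
Program : Set → Set
Program Atom = List (Rule Atom)

module _ {Atom : Set} where

  fr : ∀ {ℓ ℓ'} → Rule Atom → (Atom → Set ℓ) → (Atom → Set ℓ') → Atom → Set (ℓ ⊔ ℓ')
  fr r S C a = (a ≡ head r) × All C (posBody r) × All (λ b → ¬ S b) (negBody r)

  AtomsP : Program Atom → Atom → Set
  AtomsP P a = Any (λ r → (a ≡ head r) ⊎ (a ∈ posBody r) ⊎ (a ∈ negBody r)) P

  _⁺ : ∀ {ℓ} → (Lit Atom → Set ℓ) → Atom → Set ℓ
  (A ⁺) a = A (pos a)

  _⁻ : ∀ {ℓ} → (Lit Atom → Set ℓ) → Atom → Set ℓ
  (A ⁻) a = A (neg a)

  _∪｛_｝ : ∀ {ℓ} → (Lit Atom → Set ℓ) → Lit Atom → Lit Atom → Set ℓ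
  _∪｛_｝ {ℓ} B x y = B y ⊎ Level.Lift ℓ (y ≡ x)

  -- Γ_P(A): least fixed point of X ↦ ⋃_{r∈P} f_r(A,X)  (inductive)
  data Γ (P : Program Atom) (A : Atom → Set) : Atom → Set where
    mk : ∀ {r a} → r ∈ P → fr r A (Γ P A) a → Γ P A a

  Γ² : Program Atom → (Atom → Set) → Atom → Set
  Γ² P A = Γ P (Γ P A)

  -- lfp(Γ²_P): intersection of all prefixed points
  LfpΓ² : Program Atom → Atom → Set₁
  LfpΓ² P a = (X : Atom → Set) → (∀ b → Γ² P X b → X b) → X a

  -- gfp(Γ²_P): union of all postfixed points
  GfpΓ² : Program Atom → Atom → Set₁
  GfpΓ² P a = Σ (Atom → Set) (λ X → (∀ b → X b → Γ² P X b) × X a)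

  WF : Program Atom → Lit Atom → Set₁
  WF P (pos a) = LfpΓ² P a
  WF P (neg a) = AtomsP P a × ¬ GfpΓ² P a

  minr : ∀ {ℓ} → Rule Atom → (Lit Atom → Set ℓ) → Atom → Set (lsuc lzero ⊔ ℓ)
  minr r A a = (C : Atom → Set) → (∀ b → A (pos b) → C b) → (∀ b → A (neg b) → ¬ C b) → fr r C C a

  maxr : ∀ {ℓ} → Rule Atom → (Lit Atom → Set ℓ) → Atom → Set (lsuc lzero ⊔ ℓ)
  maxr r A a = Σ (Atom → Set) (λ C → (∀ b → A (pos b) → C b) × (∀ b → A (neg b) → ¬ C b) × fr r C C a)

  data AtleastOp (P : Program Atom) (A : Lit Atom → Set₁) (B : Lit Atom → Set) : Lit Atom → Set₁ where
    fromA : ∀ {x} → A x → AtleastOp P A B x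
    fromB : ∀ {x} → B x → AtleastOp P A B x
    byMin : ∀ {a r} → AtomsP P a → r ∈ P → minr r B a → AtleastOp P A B (pos a)
    byMax : ∀ {a} → AtomsP P a → (∀ r → r ∈ P → ¬ maxr r B a) → AtleastOp P A B (neg a)
    byOnlyRule : ∀ {a r x} → B (pos a) → r ∈ P → maxr r B a
               → (∀ r' → r' ∈ P → maxr r' B a → r' ≡ r)
               → ¬ maxr r (B ∪｛ x ｝) a → AtleastOp P A B (bar x)
    byNeg : ∀ {a r x} → B (neg a) → r ∈ P → minr r (B ∪｛ x ｝) a → AtleastOp P A B (bar x)

  -- Atleast(P,A): least fixed point of f = intersection of all B with f(B) ⊆ B
  Atleast : Program Atom → (Lit Atom → Set₁) → Lit Atom → Set₁
  Atleast P A x = (B : Lit Atom → Set) → (∀ y → AtleastOp P A B y → B y) → B x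

  -- Atmost(P,A): least fixed point of X ↦ ⋃_r f_r(A⁺, X ∖ A⁻) ∖ A⁻  (inductive)
  data Atmost (P : Program Atom) (A : Lit Atom → Set₁) : Atom → Set₁ where
    mk : ∀ {r a} → r ∈ P → fr r (A ⁺) (λ b → Atmost P A b × ¬ A (neg b)) a → ¬ A (neg a)
       → Atmost P A a

  expandStep : Program Atom → (Lit Atom → Set₁) → Lit Atom → Set₁
  expandStep P A (pos a) = Atleast P A (pos a)
  expandStep P A (neg a) = Atleast P A (neg a) ⊎ (AtomsP P a × ¬ Atmost P (Atleast P A) a)

  expandIter : Program Atom → (Lit Atom → Set₁) → ℕ → Lit Atom → Set₁
  expandIter P A zero    = A
  expandIter P A (suc n) = expandStep P (expandIter P A n)

  -- the rounds form an increasing chain; the value at which it stops changing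
  -- is the union of the chain
  expand : Program Atom → (Lit Atom → Set₁) → Lit Atom → Set₁
  expand P A x = ∃ (λ n → expandIter P A n x)

  ∅ : Lit Atom → Set₁
  ∅ _ = ⊥

{-# OPTIONS --safe #-}
module Submission where

-- The Kleene iterates Kᵢ = Γ²ⁱ(∅) increase and consist of rule heads, so they stop growing
-- after |P| + 1 steps. Membership is undecidable, so this is first shown in ¬¬-form and
-- then sharpened using that Γ(S) inspects S only negatively. The stable K contains lfp Γ²,
-- and Γ(K) is a postfixed point of Γ², so every atom of P outside Γ(K) lies outside gfp Γ².
-- By induction on i, each atom of Kᵢ is derived through min_r by Atleast in round 2i of
-- expand, and each atom of P outside Γ(Kᵢ) is refuted in round 2i + 1, because
-- Atmost(P, A) ⊆ Γ(Kᵢ) as soon as Kᵢ ⊆ A⁺.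

open import Defs
open import Level using (Level; 0ℓ; _⊔_)
open import Function using (_∘_)
open import Data.Nat using (ℕ; zero; suc; _*_; _≤_; s≤s⁻¹)
open import Data.Nat.Properties using (≤-reflexive)
open import Data.List using (List; []; _∷_; map; length)
open import Data.List.Properties using (length-map; length-removeAt′)
open import Data.List.Membership.Propositional using (_∈_)
open import Data.List.Membership.Propositional.Properties using (∈-map⁺)
open import Data.List.Relation.Unary.All as All using (All; []; _∷_)
open import Data.List.Relation.Unary.Any as Any using (here; there; index; _─_)
open import Data.Product using (_×_; _,_; proj₁)
open import Data.Sum using (_⊎_; inj₁; inj₂)
open import Data.Empty using (⊥)
open import Relation.Nullary using (¬_; contradiction)
open import Relation.Unary using (Pred; _⊆_; ∁; _∪_)
open import Relation.Binary.PropositionalEquality using (_≡_; refl; subst)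

module _ {a : Level} {A : Set a} where

  ∈-─ : ∀ {xs : List A} {x y} (x∈xs : x ∈ xs) → y ∈ xs → y ≡ x ⊎ y ∈ (xs ─ x∈xs)
  ∈-─ (here refl) (here refl)  = inj₁ refl
  ∈-─ (here refl) (there y∈xs) = inj₂ y∈xs
  ∈-─ (there x∈xs) (here refl) = inj₂ (here refl)
  ∈-─ (there x∈xs) (there y∈xs) with ∈-─ x∈xs y∈xs
  ... | inj₁ y≡x    = inj₁ y≡x
  ... | inj₂ y∈xs─x = inj₂ (there y∈xs─x)

  length-─ : ∀ {xs : List A} {x n} (x∈xs : x ∈ xs) → length xs ≤ suc n → length (xs ─ x∈xs) ≤ n
  length-─ {xs} x∈xs = s≤s⁻¹ ∘ subst (_≤ _) (length-removeAt′ xs (index x∈xs))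

module _ {a ℓ : Level} {A : Set a} where

  Increasing : (ℕ → Pred A ℓ) → Set (a ⊔ ℓ)
  Increasing K = ∀ i → K i ⊆ K (suc i)

  ¬¬-StabilityPropagates : (ℕ → Pred A ℓ) → Set (a ⊔ ℓ)
  ¬¬-StabilityPropagates K = ∀ i → K (suc i) ⊆ ∁ (∁ (K i)) → K (suc (suc i)) ⊆ K (suc i)

  stable-from-¬¬-stable-start : ∀ {K} → ¬¬-StabilityPropagates K → K 1 ⊆ ∁ (∁ (K 0)) →
                                ∀ j → K (suc (suc j)) ⊆ K (suc j)
  stable-from-¬¬-stable-start propagates start zero    = propagates 0 start
  stable-from-¬¬-stable-start propagates start (suc j) =
    propagates (suc j) (contradiction ∘ stable-from-¬¬-stable-start propagates start j)

  chain-¬¬-stabilises : ∀ n {K} → Increasing K → ¬¬-StabilityPropagates K →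
                        (hs : List A) → length hs ≤ n → (∀ i → K i ⊆ K 0 ∪ (_∈ hs)) →
                        K (suc n) ⊆ ∁ (∁ (K n))
  chain-¬¬-stabilises zero increasing propagates [] _ bounded b∈K₁ b∉K₀ with bounded 1 b∈K₁
  ... | inj₁ b∈K₀ = b∉K₀ b∈K₀
  chain-¬¬-stabilises (suc n) {K} increasing propagates hs length≤ bounded b∈ b∉ =
    b∉ (stable-from-¬¬-stable-start propagates K₁⊆¬¬K₀ n b∈)
    where
    -- A new element c ∈ K 1 ∖ K 0 bounds the shifted chain by the shorter list hs ─ c,
    -- so the induction hypothesis already refutes b∉; no witness has to be extracted.
    K₁⊆¬¬K₀ : K 1 ⊆ ∁ (∁ (K 0))
    K₁⊆¬¬K₀ c∈K₁ c∉K₀ with bounded 1 c∈K₁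
    ... | inj₁ c∈K₀ = c∉K₀ c∈K₀
    ... | inj₂ c∈hs = chain-¬¬-stabilises n (λ i → increasing (suc i)) (λ i → propagates (suc i))
                        (hs ─ c∈hs) (length-─ c∈hs length≤) shifted-bounded b∈ b∉
      where
      shifted-bounded : ∀ i → K (suc i) ⊆ K 1 ∪ (_∈ (hs ─ c∈hs))
      shifted-bounded i y∈K with bounded (suc i) y∈K
      ... | inj₁ y∈K₀ = inj₁ (increasing 0 y∈K₀)
      ... | inj₂ y∈hs with ∈-─ c∈hs y∈hs
      ...   | inj₁ refl    = inj₁ c∈K₁
      ...   | inj₂ y∈hs─c = inj₂ y∈hs─c

module _ {Atom : Set} (P : Program Atom) where

  head∈AtomsP : ∀ {r} → r ∈ P → AtomsP P (head r)
  head∈AtomsP = Any.map λ { refl → inj₁ refl }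

  negBody⊆AtomsP : ∀ {r b} → r ∈ P → b ∈ negBody r → AtomsP P b
  negBody⊆AtomsP r∈P b∈negBody = Any.map (λ { refl → inj₂ (inj₂ b∈negBody) }) r∈P

  Γ-induction : ∀ {ℓ} {S : Pred Atom 0ℓ} {X : Pred Atom ℓ} →
                (∀ {r a} → r ∈ P → fr r S X a → X a) → Γ P S ⊆ X
  Γ-induction {S = S} {X} closed = go
    where
    mutual
      go : Γ P S ⊆ X
      go (mk r∈P (a≡h , posΓ , negS)) = closed r∈P (a≡h , goAll posΓ , negS)

      goAll : ∀ {xs} → All (Γ P S) xs → All X xs
      goAll []       = []
      goAll (g ∷ gs) = go g ∷ goAll gs

  Atmost-induction : ∀ {ℓ} {A : Lit Atom → Set₁} {X : Pred Atom ℓ} →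
                     (∀ {r a} → r ∈ P → fr r (A ⁺) (λ b → X b × ¬ A (neg b)) a → ¬ A (neg a) → X a) →
                     Atmost P A ⊆ X
  Atmost-induction {A = A} {X} closed = go
    where
    mutual
      go : Atmost P A ⊆ X
      go (mk r∈P (a≡h , posAtmost , negA) a∉A⁻) = closed r∈P (a≡h , goAll posAtmost , negA) a∉A⁻

      goAll : ∀ {xs} → All (λ b → Atmost P A b × ¬ A (neg b)) xs → All (λ b → X b × ¬ A (neg b)) xs
      goAll []                  = []
      goAll ((m , b∉A⁻) ∷ ms) = (go m , b∉A⁻) ∷ goAll ms

  Γ-antitone-¬¬ : ∀ {S S′ : Pred Atom 0ℓ} → S ⊆ ∁ (∁ S′) → Γ P S′ ⊆ Γ P S
  Γ-antitone-¬¬ {S} S⊆¬¬S′ = Γ-induction {X = Γ P S} λ r∈P (a≡h , posΓ , negS′) →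
    mk r∈P (a≡h , posΓ , All.map (λ b∉S′ b∈S → S⊆¬¬S′ b∈S b∉S′) negS′)

  Γ-antitone : ∀ {S S′ : Pred Atom 0ℓ} → S ⊆ S′ → Γ P S′ ⊆ Γ P S
  Γ-antitone S⊆S′ = Γ-antitone-¬¬ (contradiction ∘ S⊆S′)

  Γ⊆heads : ∀ {S} → Γ P S ⊆ (_∈ map head P)
  Γ⊆heads (mk r∈P (refl , _)) = ∈-map⁺ head r∈P

  Atleast-inflationary : ∀ {A} → A ⊆ Atleast P A
  Atleast-inflationary x∈A _ closed = closed _ (fromA x∈A)

  Γ⊆Atleast⁺ : ∀ {A : Lit Atom → Set₁} {S : Pred Atom 0ℓ} →
               (∀ {b} → AtomsP P b → ¬ S b → A (neg b)) → Γ P S ⊆ Atleast P A ⁺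
  Γ⊆Atleast⁺ {A} {S} A⁻⊇Atoms∖S a∈Γ B closed = Γ-induction derive a∈Γ
    where
    derive : ∀ {r a} → r ∈ P → fr r S (B ⁺) a → B (pos a)
    derive {r} r∈P (refl , posB , negS) = closed _ (byMin (head∈AtomsP r∈P) r∈P min)
      where
      min : minr r B (head r)
      min C B⁺⊆C B⁻∩C≡∅ = refl , All.map (B⁺⊆C _) posB , All.tabulate λ b∈negBody →
        B⁻∩C≡∅ _ (closed _ (fromA (A⁻⊇Atoms∖S (negBody⊆AtomsP r∈P b∈negBody) (All.lookup negS b∈negBody))))

  Atmost⊆Γ : ∀ {A : Lit Atom → Set₁} {S : Pred Atom 0ℓ} → S ⊆ A ⁺ → Atmost P A ⊆ Γ P S
  Atmost⊆Γ {S = S} S⊆A⁺ = Atmost-induction {X = Γ P S} λ r∈P (a≡h , posAtmost , negA⁺) _ →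
    mk r∈P (a≡h , All.map proj₁ posAtmost , All.map (λ b∉A⁺ b∈S → b∉A⁺ (S⊆A⁺ b∈S)) negA⁺)

  Γ²-iterate : ℕ → Pred Atom 0ℓ
  Γ²-iterate zero    = λ _ → ⊥
  Γ²-iterate (suc i) = Γ² P (Γ²-iterate i)

  Γ²-iterate-increasing : Increasing Γ²-iterate
  Γ²-iterate-increasing zero    ()
  Γ²-iterate-increasing (suc i) = Γ-antitone (Γ-antitone (Γ²-iterate-increasing i))

  Γ²-iterate-¬¬-stability-propagates : ¬¬-StabilityPropagates Γ²-iterate
  Γ²-iterate-¬¬-stability-propagates i = Γ-antitone ∘ Γ-antitone-¬¬

  Γ²-iterate⊆heads : ∀ i → Γ²-iterate i ⊆ Γ²-iterate 0 ∪ (_∈ map head P)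
  Γ²-iterate⊆heads zero    ()
  Γ²-iterate⊆heads (suc i) = inj₂ ∘ Γ⊆heads

  stable-stage : ℕ
  stable-stage = suc (length P)

  Γ²-iterate-stable : Γ² P (Γ²-iterate stable-stage) ⊆ Γ²-iterate stable-stage
  Γ²-iterate-stable =
    Γ²-iterate-¬¬-stability-propagates (length P)
      (chain-¬¬-stabilises (length P) Γ²-iterate-increasing Γ²-iterate-¬¬-stability-propagates
        (map head P) (≤-reflexive (length-map head P)) Γ²-iterate⊆heads)

  LfpΓ²⊆Γ²-iterate : LfpΓ² P ⊆ Γ²-iterate stable-stage
  LfpΓ²⊆Γ²-iterate a∈lfp = a∈lfp _ (λ _ → Γ²-iterate-stable)

  Γ-Γ²-iterate⊆GfpΓ² : Γ P (Γ²-iterate stable-stage) ⊆ GfpΓ² P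
  Γ-Γ²-iterate⊆GfpΓ² a∈Γ = _ , (λ _ → Γ-antitone Γ²-iterate-stable) , a∈Γ

  mutual
    Γ²-iterate⊆expand⁺ : ∀ i → Γ²-iterate i ⊆ expandIter P ∅ (i * 2) ⁺
    Γ²-iterate⊆expand⁺ zero    ()
    Γ²-iterate⊆expand⁺ (suc i) = Γ⊆Atleast⁺ (Atoms∖Γ⊆expand⁻ i)

    Atoms∖Γ⊆expand⁻ : ∀ i {b} → AtomsP P b → ¬ Γ P (Γ²-iterate i) b →
                      expandIter P ∅ (suc (i * 2)) (neg b)
    Atoms∖Γ⊆expand⁻ i b∈Atoms b∉Γ =
      inj₂ (b∈Atoms , b∉Γ ∘ Atmost⊆Γ (Atleast-inflationary ∘ Γ²-iterate⊆expand⁺ i))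

mainTheorem16 : {Atom : Set} (P : Program Atom) (x : Lit Atom) → WF P x → expand P ∅ x
mainTheorem16 P (pos a) a∈lfp =
  stable-stage P * 2 , Γ²-iterate⊆expand⁺ P (stable-stage P) (LfpΓ²⊆Γ²-iterate P a∈lfp)
mainTheorem16 P (neg a) (a∈Atoms , a∉gfp) =
  suc (stable-stage P * 2) , Atoms∖Γ⊆expand⁻ P (stable-stage P) a∈Atoms (a∉gfp ∘ Γ-Γ²-iterate⊆GfpΓ² P)
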